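{- Let $a_1,\dots,a_n$ be positive integers and let $G$ be the graph constructed from them as described in the context. Let $\vec{G}$ be any strongly connected orientation of $G$, let $\vec{P}$ be a directed path from $s$ to $t$ in $\vec{G}$, and let $\vec{Q}$ be a directed path from $t$ to $s$ in $\vec{G}$. Then every top edge $(v_i,v_{i+1})$, $1 \le i \le n$, belongs to exactly one of $\vec{P}$ and $\vec{Q}$.
   Context: Construction of $G$ from positive integers $a_1,\dots,a_n$: start with a $2\times(n+1)$ grid graph with top row $v_1,\dots,v_{n+1}$ and bottom row $w_1,\dots,w_{n+1}$, i.e., edges $(v_i,v_{i+1})$ ("top edges", with $(v_i,v_{i+1})$ given weight $a_i$), edges $(w_i,w_{i+1})$ for $1\le i\le n$, and vertical edges $(v_i,w_i)$ for $1\le i\le n+1$. Subdivide the vertical edge $(v_1,w_1)$ by a new vertex $s$ and the vertical edge $(v_{n+1},w_{n+1})$ by a new vertex $t$. Replace each internal vertical edge $(v_i,w_i)$, $1<i<n+1$, by a $4$-cycle $v_i, d_i, w_i, d'_i, v_i$ where $d_i,d'_i$ are new vertices. All edges other than top edges receive weight $1/m$, where $m$ is the number of edges of the resulting graph (weights play no role in this statement). A strongly connected orientation assigns a direction to each edge so that every vertex reaches every other by a directed path; directed paths are simple (no repeated vertices). -}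

module Defs where

open import Data.Nat using (ℕ; zero; suc; _∸_)
open import Data.Fin using (Fin; zero; suc; inject₁)
open import Data.Bool using (Bool; true; false; if_then_else_)
open import Data.Product using (_×_; _,_; proj₁; proj₂; ∃)
open import Data.List using (List; []; _∷_; map)
open import Data.List.Relation.Unary.Unique.Propositional using (Unique)
open import Relation.Binary.PropositionalEquality using (_≡_)

-- Vertices of G built from a₁,…,aₙ (0-based indices):
--   v i, w i  for i : Fin (n+1)   stand for v_{i+1}, w_{i+1}
--   s, t
--   d j, d' j for j : Fin (n ∸ 1) stand for d_{j+2}, d'_{j+2}
--     (the internal indices 1 < i < n+1)
data V (n : ℕ) : Set where
  v  : Fin (suc n) → V n
  w  : Fin (suc n) → V n
  s  : V n
  t  : V n
  d  : Fin (n ∸ 1) → V n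
  d' : Fin (n ∸ 1) → V n

-- index of v_{j+2} for j : Fin (n ∸ 1)
mid : (n : ℕ) → Fin (n ∸ 1) → Fin (suc n)
mid zero ()
mid (suc zero) ()
mid (suc (suc n)) j = suc (inject₁ j)

last : (n : ℕ) → Fin (suc n)
last zero = zero
last (suc n) = suc (last n)

data Edge (n : ℕ) : Set where
  top  : Fin n → Edge n          -- (v_i, v_{i+1}), weight a_i
  bot  : Fin n → Edge n
  sv   : Edge n
  sw   : Edge n
  tv   : Edge n
  tw   : Edge n
  vd   : Fin (n ∸ 1) → Edge n
  dw   : Fin (n ∸ 1) → Edge n
  wd'  : Fin (n ∸ 1) → Edge n
  d'v  : Fin (n ∸ 1) → Edge n

ends : (n : ℕ) → Edge n → V n × V n
ends n (top i) = v (inject₁ i) , v (suc i)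
ends n (bot i) = w (inject₁ i) , w (suc i)
ends n sv      = s , v zero
ends n sw      = s , w zero
ends n tv      = t , v (last n)
ends n tw      = t , w (last n)
ends n (vd j)  = v (mid n j) , d j
ends n (dw j)  = d j , w (mid n j)
ends n (wd' j) = w (mid n j) , d' j
ends n (d'v j) = d' j , v (mid n j)

-- An orientation chooses, for each edge, whether it is directed
-- from the first to the second listed endpoint (true) or reversed (false).
Orientation : ℕ → Set
Orientation n = Edge n → Bool

tail : {n : ℕ} → Orientation n → Edge n → V n
tail {n} o e = if o e then proj₁ (ends n e) else proj₂ (ends n e)

head : {n : ℕ} → Orientation n → Edge n → V n
head {n} o e = if o e then proj₂ (ends n e) else proj₁ (ends n e)

data Walk {n : ℕ} (o : Orientation n) : V n → V n → List (Edge n) → Set where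
  []   : ∀ {x} → Walk o x x []
  step : ∀ {x y e es} → tail o e ≡ x → Walk o (head o e) y es → Walk o x y (e ∷ es)

DirPath : {n : ℕ} → Orientation n → V n → V n → List (Edge n) → Set
DirPath o x y es = Walk o x y es × Unique (x ∷ map (head o) es)

StronglyConnected : {n : ℕ} → Orientation n → Set
StronglyConnected {n} o = (x y : V n) → ∃ λ es → DirPath o x y es

-- The edges top i and bot i form a cut separating s from t, and every other
-- edge joins two vertices on the same side of it. P must cross this cut from
-- the side of s to the side of t and Q must cross it back, so the two cut edges
-- are oriented in opposite directions and each path uses the one pointing its
-- way. Neither path can use the other one: after crossing against its overall
-- direction it would have to cross in its own direction twice, i.e. traverse
-- the unique cut edge pointing that way twice and repeat a vertex.
module Submission where

open import Defs
open import Data.Nat using (ℕ; suc; _<_)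
open import Data.Fin using (Fin; zero; suc; inject₁; _≟_)
open import Data.Bool using (Bool; true; false; not)
import Data.Bool.Properties as Bool
open import Data.Product using (_×_; _,_; proj₁; proj₂; ∃-syntax)
open import Data.Sum using (_⊎_; inj₁; inj₂)
open import Data.List using (List; []; _∷_; _++_)
open import Data.List.Membership.Propositional using (_∈_; _∉_)
open import Data.List.Membership.Propositional.Properties using (∈-∃++; ∈-++⁺ʳ)
open import Data.List.Relation.Unary.Any using (here; there)
open import Data.List.Relation.Unary.All using (lookup)
open import Data.List.Relation.Unary.AllPairs using (_∷_)
open import Data.List.Relation.Unary.Unique.Propositional using (Unique)
open import Data.List.Relation.Unary.Unique.Propositional.Properties using (map⁻)
open import Data.List.Relation.Binary.Disjoint.Propositional using (Disjoint)
open import Relation.Binary.PropositionalEquality using (_≡_; _≢_; refl; sym; trans; cong; subst)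
open import Function using (_∘′_)
open import Relation.Nullary using (¬_; yes; no; contradiction)

Unique-++⇒Disjoint : ∀ {A : Set} (xs : List A) {ys} → Unique (xs ++ ys) → Disjoint xs ys
Unique-++⇒Disjoint (_ ∷ xs) (x∉ys ∷ _) (here refl , x∈ys) = lookup x∉ys (∈-++⁺ʳ xs x∈ys) refl
Unique-++⇒Disjoint (_ ∷ xs) (_ ∷ u)    (there z∈xs , z∈ys) = Unique-++⇒Disjoint xs u (z∈xs , z∈ys)

module Cut {n : ℕ} (o : Orientation n) (σ : V n → Bool) where

  Leaves : Bool → Edge n → Set
  Leaves b e = σ (tail o e) ≡ b × σ (head o e) ≡ not b

  Leaves-functional : ∀ {b c e} → Leaves b e → Leaves c e → b ≡ c
  Leaves-functional (σt≡b , _) (σt≡c , _) = trans (sym σt≡b) σt≡c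

  ends-side⇒arc-side : ∀ e → σ (proj₁ (ends n e)) ≡ σ (proj₂ (ends n e)) →
                       σ (tail o e) ≡ σ (head o e)
  ends-side⇒arc-side e eq with o e
  ... | true  = eq
  ... | false = sym eq

  walk-leaves : ∀ {x y es b} → Walk o x y es → σ x ≡ b → σ y ≡ not b →
                ∃[ e ] e ∈ es × Leaves b e
  walk-leaves [] σx≡b σx≡¬b = contradiction (trans (sym σx≡b) σx≡¬b) (Bool.not-¬ refl)
  walk-leaves {b = b} (step {e = e} refl W) σx≡b σy≡¬b with σ (head o e) Bool.≟ b
  ... | yes σh≡b = let f , f∈ , f-leaves = walk-leaves W σh≡b σy≡¬b in f , there f∈ , f-leaves
  ... | no  σh≢b = e , here refl , σx≡b , Bool.¬-not σh≢b

  walk-split : ∀ {x y} xs {e ys} → Walk o x y (xs ++ e ∷ ys) →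
               Walk o x (tail o e) xs × Walk o (head o e) y ys
  walk-split []       (step refl W) = [] , W
  walk-split (_ ∷ xs) (step p W)    = let W₁ , W₂ = walk-split xs W in step p W₁ , W₂

  -- Re-entering side b splits the path into two pieces that both leave side b.
  path-never-reenters : ∀ {x y es e b} → DirPath o x y es → σ x ≡ b → σ y ≡ not b →
                        (∀ {f g} → Leaves b f → Leaves b g → f ≡ g) →
                        Leaves (not b) e → e ∉ es
  path-never-reenters {b = b} (W , _ ∷ U) σx≡b σy≡¬b leaving-unique (σt≡¬b , σh≡¬¬b) e∈es
    with ∈-∃++ e∈es
  ... | xs , ys , refl with walk-split xs W
  ... | W₁ , W₂ with walk-leaves W₁ σx≡b σt≡¬b
                   | walk-leaves W₂ (trans σh≡¬¬b (Bool.not-involutive b)) σy≡¬b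
  ... | f , f∈xs , f-leaves | g , g∈ys , g-leaves with leaving-unique f-leaves g-leaves
  ... | refl = Unique-++⇒Disjoint xs (map⁻ U) (f∈xs , there g∈ys)

atOrBefore : ∀ {n} → Fin (suc n) → Fin n → Bool
atOrBefore zero    _       = true
atOrBefore (suc j) zero    = false
atOrBefore (suc j) (suc i) = atOrBefore j i

atOrBefore-inject₁-self : ∀ {n} (i : Fin n) → atOrBefore (inject₁ i) i ≡ true
atOrBefore-inject₁-self zero    = refl
atOrBefore-inject₁-self (suc i) = atOrBefore-inject₁-self i

atOrBefore-suc-self : ∀ {n} (i : Fin n) → atOrBefore (suc i) i ≡ false
atOrBefore-suc-self zero    = refl
atOrBefore-suc-self (suc i) = atOrBefore-suc-self i

atOrBefore-inject₁≡suc : ∀ {n} {k i : Fin n} → k ≢ i →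
                         atOrBefore (inject₁ k) i ≡ atOrBefore (suc k) i
atOrBefore-inject₁≡suc {k = zero}  {zero}  k≢i = contradiction refl k≢i
atOrBefore-inject₁≡suc {k = zero}  {suc i} _   = refl
atOrBefore-inject₁≡suc {k = suc k} {zero}  _   = refl
atOrBefore-inject₁≡suc {k = suc k} {suc i} k≢i = atOrBefore-inject₁≡suc (λ k≡i → k≢i (cong suc k≡i))

atOrBefore-last : ∀ {n} (i : Fin n) → atOrBefore (last n) i ≡ false
atOrBefore-last zero    = refl
atOrBefore-last (suc i) = atOrBefore-last i

sourceSide : ∀ {n} → Fin n → V n → Bool
sourceSide i (v j)  = atOrBefore j i
sourceSide i (w j)  = atOrBefore j i
sourceSide i s      = true
sourceSide i t      = false
sourceSide i (d j)  = atOrBefore (mid _ j) i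
sourceSide i (d' j) = atOrBefore (mid _ j) i

CutEdge : ∀ {n} → Fin n → Edge n → Set
CutEdge i e = e ≡ top i ⊎ e ≡ bot i

cutEdge-or-sameSide : ∀ {n} (i : Fin n) e →
  CutEdge i e ⊎ sourceSide i (proj₁ (ends n e)) ≡ sourceSide i (proj₂ (ends n e))
cutEdge-or-sameSide i (top k) with k ≟ i
... | yes refl = inj₁ (inj₁ refl)
... | no  k≢i  = inj₂ (atOrBefore-inject₁≡suc k≢i)
cutEdge-or-sameSide i (bot k) with k ≟ i
... | yes refl = inj₁ (inj₂ refl)
... | no  k≢i  = inj₂ (atOrBefore-inject₁≡suc k≢i)
cutEdge-or-sameSide i sv      = inj₂ refl
cutEdge-or-sameSide i sw      = inj₂ refl
cutEdge-or-sameSide i tv      = inj₂ (sym (atOrBefore-last i))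
cutEdge-or-sameSide i tw      = inj₂ (sym (atOrBefore-last i))
cutEdge-or-sameSide i (vd j)  = inj₂ refl
cutEdge-or-sameSide i (dw j)  = inj₂ refl
cutEdge-or-sameSide i (wd' j) = inj₂ refl
cutEdge-or-sameSide i (d'v j) = inj₂ refl

module TopEdge {n : ℕ} (o : Orientation n) (i : Fin n) where
  open Cut o (sourceSide i)

  leaves⇒cutEdge : ∀ {b e} → Leaves b e → CutEdge i e
  leaves⇒cutEdge {e = e} (σt≡b , σh≡¬b) with cutEdge-or-sameSide i e
  ... | inj₁ cut  = cut
  ... | inj₂ same = contradiction (trans (sym σt≡b) (trans (ends-side⇒arc-side e same) σh≡¬b))
                                  (Bool.not-¬ refl)

  leaves-unique : ∀ {b c e f g} → b ≢ c → Leaves c g → Leaves b e → Leaves b f → e ≡ f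
  leaves-unique b≢c g-leaves e-leaves f-leaves
    with leaves⇒cutEdge e-leaves | leaves⇒cutEdge f-leaves | leaves⇒cutEdge g-leaves
  ... | inj₁ refl | inj₁ refl | _         = refl
  ... | inj₂ refl | inj₂ refl | _         = refl
  ... | inj₁ refl | inj₂ refl | inj₁ refl = contradiction (Leaves-functional e-leaves g-leaves) b≢c
  ... | inj₁ refl | inj₂ refl | inj₂ refl = contradiction (Leaves-functional f-leaves g-leaves) b≢c
  ... | inj₂ refl | inj₁ refl | inj₁ refl = contradiction (Leaves-functional f-leaves g-leaves) b≢c
  ... | inj₂ refl | inj₁ refl | inj₂ refl = contradiction (Leaves-functional e-leaves g-leaves) b≢c

  top-leaves : Leaves (o (top i)) (top i)
  top-leaves with o (top i)
  ... | true  = atOrBefore-inject₁-self i , atOrBefore-suc-self i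
  ... | false = atOrBefore-suc-self i , atOrBefore-inject₁-self i

  top∈crossing-path : ∀ {b x y x' y' R R'} → o (top i) ≡ b →
    DirPath o x y R → sourceSide i x ≡ b → sourceSide i y ≡ not b →
    DirPath o x' y' R' → sourceSide i x' ≡ not b → sourceSide i y' ≡ not (not b) →
    top i ∈ R × top i ∉ R'
  top∈crossing-path {R = R} {R' = R'} refl (W , _) σx σy P' σx' σy'
    with walk-leaves W σx σy | walk-leaves (proj₁ P') σx' σy'
  ... | e , e∈R , e-leaves | g , _ , g-leaves = top∈R , top∉R'
    where
      b≢¬b : o (top i) ≢ not (o (top i))
      b≢¬b = Bool.not-¬ refl

      top∈R : top i ∈ R
      top∈R with leaves-unique b≢¬b g-leaves top-leaves e-leaves
      ... | refl = e∈R

      top∉R' : top i ∉ R'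
      top∉R' = path-never-reenters P' σx' σy'
                 (leaves-unique (b≢¬b ∘′ sym) top-leaves)
                 (subst (λ c → Leaves c (top i)) (sym (Bool.not-involutive _)) top-leaves)

lemma2 : (n : ℕ) (a : Fin n → ℕ) → (∀ i → 0 < a i) →
    (o : Orientation n) → StronglyConnected o →
    (P Q : List (Edge n)) → DirPath o s t P → DirPath o t s Q →
    (i : Fin n) →
    ((top i ∈ P) × ¬ (top i ∈ Q)) ⊎ (¬ (top i ∈ P) × (top i ∈ Q))
lemma2 n _ _ o _ P Q P-path Q-path i with o (top i) in top-dir
... | true  = inj₁ (TopEdge.top∈crossing-path o i top-dir P-path refl refl Q-path refl refl)
... | false = let top∈Q , top∉P = TopEdge.top∈crossing-path o i top-dir Q-path refl refl P-path refl refl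
              in inj₂ (top∉P , top∈Q)
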